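{- Let $\mathcal{P}$ be an instance of the discrete data-center optimization problem in which $m$ is a power of two with $m\ge 4$, and let $K=\log_2 m-2$. Consider the following procedure. In iteration $k=K$, compute a schedule $\hat X^K$ of minimum cost among all schedules with $x_t\in\{0,m/4,m/2,3m/4,m\}$ for all $t$. For $k=K,K-1,\dots,1$, given the schedule $\hat X^k=(\hat x^k_1,\dots,\hat x^k_T)$ from iteration $k$, iteration $k-1$ computes a schedule $\hat X^{k-1}$ of minimum cost among all schedules with $x_t\in V^{k-1}_t$ for all $t$, where $V^{k-1}_t=\{\hat x^k_t+\xi\cdot 2^{k-1}:\xi\in\{ -2,-1,0,1,2\}\}\cap\{0,\dots,m\}$. The procedure outputs $\hat X^0$. Then $\hat X^0$ is an optimal schedule for $\mathcal{P}$.
   Context: Discrete data-center optimization problem: an instance $\mathcal{P}$ consists of $T\in\mathbb{N}$, $m\in\mathbb{N}$, $\beta>0$ and functions $f_1,\dots,f_T:\{0,\dots,m\}\to\mathbb{R}_{\ge0}$, each convex (i.e. $f_t(x+1)-f_t(x)$ is nondecreasing in $x$). A schedule is $X=(x_1,\dots,x_T)$ with $x_t\in\{0,\dots,m\}$; with $x_0=0$ its cost is $C(X)=\sum_{t=1}^T f_t(x_t)+\beta\sum_{t=1}^T(x_t-x_{t-1})^+$, where $(y)^+=\max(0,y)$. A schedule is optimal if it minimizes $C$ over $\{0,\dots,m\}^T$.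
   Formalization: The functions $f_1,\dots,f_T$ take values in the nonnegative rationals instead of $\mathbb{R}_{\ge0}$, and β is a positive rational rather than a positive real. -}

module Defs where

open import Data.Nat as ℕ using (ℕ; zero; suc; _∸_; _^_)
open import Data.Integer as ℤ using (ℤ; +_)
open import Data.Rational as ℚ using (ℚ; 0ℚ; _/_)
open import Data.Fin using (Fin)
open import Data.Vec using (Vec; []; _∷_; lookup)
open import Data.Product using (Σ; _×_; ∃-syntax)

ℕ→ℚ : ℕ → ℚ
ℕ→ℚ n = (+ n) / 1

-- An instance: T slots, m servers, switching cost β, per-slot cost functions f_t
-- (only the values on {0,…,m} are relevant). Schedules are vectors of length T.

costFrom : ∀ {n} → ℚ → ℕ → Vec (ℕ → ℚ) n → Vec ℕ n → ℚ
costFrom β prev [] [] = 0ℚ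
costFrom β prev (f ∷ fs) (x ∷ xs) =
  f x ℚ.+ β ℚ.* ℕ→ℚ (x ∸ prev) ℚ.+ costFrom β x fs xs

cost : ∀ {T} → ℚ → Vec (ℕ → ℚ) T → Vec ℕ T → ℚ
cost β fs xs = costFrom β 0 fs xs

NonNeg : ∀ {T} → ℕ → Vec (ℕ → ℚ) T → Set
NonNeg {T} m fs = ∀ (t : Fin T) (x : ℕ) → x ℕ.≤ m → 0ℚ ℚ.≤ lookup fs t x

Convex : ∀ {T} → ℕ → Vec (ℕ → ℚ) T → Set
Convex {T} m fs = ∀ (t : Fin T) (x : ℕ) → suc (suc x) ℕ.≤ m →
  lookup fs t (suc x) ℚ.- lookup fs t x ℚ.≤ lookup fs t (suc (suc x)) ℚ.- lookup fs t (suc x)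

Feasible : ∀ {T} → ℕ → Vec ℕ T → Set
Feasible {T} m xs = ∀ (t : Fin T) → lookup xs t ℕ.≤ m

Optimal : ∀ {T} → ℕ → ℚ → Vec (ℕ → ℚ) T → Vec ℕ T → Set
Optimal m β fs X = Feasible m X × (∀ Y → Feasible m Y → cost β fs X ℚ.≤ cost β fs Y)

MinCostAmong : ∀ {T} → ℚ → Vec (ℕ → ℚ) T → (Fin T → ℕ → Set) → Vec ℕ T → Set
MinCostAmong {T} β fs S X =
  (∀ t → S t (lookup X t)) ×
  (∀ Y → (∀ t → S t (lookup Y t)) → cost β fs X ℚ.≤ cost β fs Y)

-- x ∈ {0, m/4, m/2, 3m/4, m} where m = 2^(K+2), i.e. x = ξ·2^K with ξ ∈ {0,…,4}
CoarseGrid : ℕ → ℕ → Set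
CoarseGrid K x = ∃[ ξ ] (ξ ℕ.≤ 4 × x ≡ ξ ℕ.* 2 ^ K)
  where open import Relation.Binary.PropositionalEquality using (_≡_)

Nbhd : ℕ → ℕ → ℕ → ℕ → Set
Nbhd m j xhat x = x ℕ.≤ m × ∃[ ξ ] ((ℤ.- (+ 2) ℤ.≤ ξ × ξ ℤ.≤ + 2) ×
  (+ x) ≡ (+ xhat) ℤ.+ ξ ℤ.* (+ (2 ^ j)))
  where open import Relation.Binary.PropositionalEquality using (_≡_)

{-# OPTIONS --safe #-}
-- Dividing by h = 2^j turns iteration j into a statement about integer schedules: the output X
-- of the previous iteration becomes an even schedule that is optimal among the even schedules in
-- {0,…,M}, and it suffices that every schedule Y in {0,…,M} costs at least as much as its clamp
-- into the band X − 1 ≤ Y ≤ X + 1, which lies in the neighbourhood searched next.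
-- Y is pushed into the band one unit at a time. For Z = X − 1 and A = {t | y_t < z_t},
--   C(Y + χ_A) + C(Z − χ_A) ≤ C(Y) + C(Z)          (exchange; convexity of the f_t),
--   C(X − 2χ_A) + 2 C(Z) ≤ C(X) + 2 C(Z − χ_A)     (three-point inequality),
-- and C(X) ≤ C(X − 2χ_A) by optimality, so C(Z) ≤ C(Z − χ_A) and hence C(Y + χ_A) ≤ C(Y).
-- Both inequalities hold slot by slot and transition by transition; in the three-point one the
-- switching terms even agree, because X is even and the kink of (·)⁺ sits at an even point.
-- Lowering Y towards X + 1 is symmetric, and a downward induction over the iterations concludes.
module Submission where

open import Defs
open import Data.Fin using (Fin)
open import Data.Integer as ℤ using (+_; _⊖_)
import Data.Integer.Divisibility.Signed as ℤ∣
import Data.Integer.Properties as ℤ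
import Data.Integer.Solver
open import Data.List as List using (List; []; _∷_; foldr)
open import Data.Maybe using (Maybe; just; nothing; maybe′)
import Data.Maybe.Relation.Unary.All as Maybe
open import Data.Nat as ℕ using (ℕ; zero; suc; _+_; _^_; _∸_; _≤_; _⊔_; _⊓_; z≤n; s≤s; _<?_)
import Data.Nat.Coprimality as Coprime
open import Data.Nat.Divisibility
  using (_∣_; divides; ∣-refl; ∣-trans; ∣m∣n⇒∣m+n; n∣m*n; *-monoˡ-∣; *-cancelʳ-∣; 1∣_)
open import Data.Nat.DivMod using (_/_; m/n*n≡m; m/n*n≤m; /-monoˡ-≤)
open import Data.Nat.ListAction using (sum)
import Data.Nat.Properties as ℕ
import Data.Nat.Solver
open import Data.Product using (_×_; _,_; proj₁; proj₂; ∃-syntax)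
open import Data.Rational as ℚ using (ℚ; 0ℚ; _<_; mkℚ)
import Data.Rational.Properties as ℚ
import Data.Rational.Solver
open import Data.Sum using (inj₁; inj₂)
open import Data.Vec as Vec using (Vec; []; _∷_; lookup)
import Data.Vec.Properties as Vec
open import Data.Vec.Relation.Unary.All as All using (All; []; _∷_)
open import Data.Vec.Relation.Unary.All.Properties using (lookup⁺; lookup⁻; map⁺)
open import Function.Bundles using (_⇔_; mk⇔; Equivalence)
open import Relation.Binary.PropositionalEquality
open import Relation.Nullary using (yes; no)

module ℕ-Solver = Data.Nat.Solver.+-*-Solver
module ℤ-Solver = Data.Integer.Solver.+-*-Solver
module ℚ-Solver = Data.Rational.Solver.+-*-Solver

ℕ→ℚ≡mkℚ : ∀ n → ℕ→ℚ n ≡ mkℚ (+ n) 0 (Coprime.sym (Coprime.1-coprimeTo n))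
ℕ→ℚ≡mkℚ n = ℚ.normalize-coprime (Coprime.sym (Coprime.1-coprimeTo n))

ℕ→ℚ-+ : ∀ m n → ℕ→ℚ (m + n) ≡ ℕ→ℚ m ℚ.+ ℕ→ℚ n
ℕ→ℚ-+ m n rewrite ℕ→ℚ≡mkℚ m | ℕ→ℚ≡mkℚ n =
  cong (ℚ._/ 1) (sym (cong₂ ℤ._+_ (ℤ.*-identityʳ (+ m)) (ℤ.*-identityʳ (+ n))))

ℕ→ℚ-* : ∀ m n → ℕ→ℚ (m ℕ.* n) ≡ ℕ→ℚ m ℚ.* ℕ→ℚ n
ℕ→ℚ-* m n rewrite ℕ→ℚ≡mkℚ m | ℕ→ℚ≡mkℚ n = cong (ℚ._/ 1) (ℤ.pos-* m n)

ℕ→ℚ-mono-≤ : ∀ {m n} → m ≤ n → ℕ→ℚ m ℚ.≤ ℕ→ℚ n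
ℕ→ℚ-mono-≤ {m} {n} m≤n rewrite ℕ→ℚ≡mkℚ m | ℕ→ℚ≡mkℚ n =
  ℚ.*≤* (subst₂ ℤ._≤_ (sym (ℤ.*-identityʳ (+ m))) (sym (ℤ.*-identityʳ (+ n))) (ℤ.+≤+ m≤n))

p-q≤r-s⇒p+s≤q+r : ∀ {p q r s} → p ℚ.- q ℚ.≤ r ℚ.- s → p ℚ.+ s ℚ.≤ q ℚ.+ r
p-q≤r-s⇒p+s≤q+r {p} {q} {r} {s} le =
  subst₂ ℚ._≤_ (shiftˡ p q s) (shiftʳ q r s) (ℚ.+-monoˡ-≤ (q ℚ.+ s) le)
  where
  open ℚ-Solver
  shiftˡ : ∀ p q s → p ℚ.- q ℚ.+ (q ℚ.+ s) ≡ p ℚ.+ s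
  shiftˡ = solve 3 (λ p q s → p :- q :+ (q :+ s) := p :+ s) refl
  shiftʳ : ∀ q r s → r ℚ.- s ℚ.+ (q ℚ.+ s) ≡ q ℚ.+ r
  shiftʳ = solve 3 (λ q r s → r :- s :+ (q :+ s) := q :+ r) refl

+-cancelʳ-≤ : ∀ c {a b} → a ℚ.+ c ℚ.≤ b ℚ.+ c → a ℚ.≤ b
+-cancelʳ-≤ c {a} {b} le = subst₂ ℚ._≤_ (cancel a c) (cancel b c) (ℚ.+-monoˡ-≤ (ℚ.- c) le)
  where
  open ℚ-Solver
  cancel : ∀ a c → a ℚ.+ c ℚ.- c ≡ a
  cancel = solve 2 (λ a c → a :+ c :- c := a) refl

+-cancel-≤ : ∀ a b c d → a ℚ.+ b ℚ.≤ c ℚ.+ d → d ℚ.≤ b → a ℚ.≤ c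
+-cancel-≤ a b c d le d≤b = +-cancelʳ-≤ b (ℚ.≤-trans le (ℚ.+-monoʳ-≤ c d≤b))

double-cancel-≤ : ∀ b d → b ℚ.+ b ℚ.≤ d ℚ.+ d → b ℚ.≤ d
double-cancel-≤ b d 2b≤2d with ℚ.≤-total b d
... | inj₁ b≤d = b≤d
... | inj₂ d≤b = +-cancel-≤ b b d d 2b≤2d d≤b

sumℚ : List ℚ → ℚ
sumℚ = foldr ℚ._+_ 0ℚ

sumℚ-const-0 : ∀ {B : Set} (bs : List B) → sumℚ (List.map (λ _ → 0ℚ) bs) ≡ 0ℚ
sumℚ-const-0 []       = refl
sumℚ-const-0 (_ ∷ bs) = trans (ℚ.+-identityˡ _) (sumℚ-const-0 bs)

pair-cancelʳ : ∀ a b c d → sumℚ (a ∷ b ∷ []) ℚ.≤ sumℚ (c ∷ d ∷ []) → d ℚ.≤ b → a ℚ.≤ c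
pair-cancelʳ a b c d le =
  +-cancel-≤ a b c d (subst₂ ℚ._≤_ (cong (a ℚ.+_) (ℚ.+-identityʳ b)) (cong (c ℚ.+_) (ℚ.+-identityʳ d)) le)

pair-cancelˡ : ∀ a b c d → sumℚ (a ∷ b ∷ []) ℚ.≤ sumℚ (c ∷ d ∷ []) → c ℚ.≤ a → b ℚ.≤ d
pair-cancelˡ a b c d le = pair-cancelʳ b a d c (subst₂ ℚ._≤_ (swap a b) (swap c d) le)
  where
  open ℚ-Solver
  swap : ∀ a b → a ℚ.+ (b ℚ.+ 0ℚ) ≡ b ℚ.+ (a ℚ.+ 0ℚ)
  swap = solve 2 (λ a b → a :+ (b :+ con 0ℚ) := b :+ (a :+ con 0ℚ)) refl

triple-cancel : ∀ a b c d →
  sumℚ (a ∷ b ∷ b ∷ []) ℚ.≤ sumℚ (c ∷ d ∷ d ∷ []) → c ℚ.≤ a → b ℚ.≤ d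
triple-cancel a b c d le c≤a =
  double-cancel-≤ b d
    (+-cancel-≤ (b ℚ.+ b) a (d ℚ.+ d) c (subst₂ ℚ._≤_ (reorder a b) (reorder c d) le) c≤a)
  where
  open ℚ-Solver
  reorder : ∀ a b → a ℚ.+ (b ℚ.+ (b ℚ.+ 0ℚ)) ≡ b ℚ.+ b ℚ.+ a
  reorder = solve 2 (λ a b → a :+ (b :+ (b :+ con 0ℚ)) := b :+ b :+ a) refl

three-point-convex : ∀ a b c →
  b ℚ.+ b ℚ.≤ a ℚ.+ c → sumℚ (a ∷ b ∷ b ∷ []) ℚ.≤ sumℚ (c ∷ a ∷ a ∷ [])
three-point-convex a b c 2b≤a+c = subst₂ ℚ._≤_ (lhs a b) (rhs a c) (ℚ.+-monoʳ-≤ a 2b≤a+c)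
  where
  open ℚ-Solver
  lhs : ∀ a b → a ℚ.+ (b ℚ.+ b) ≡ a ℚ.+ (b ℚ.+ (b ℚ.+ 0ℚ))
  lhs = solve 2 (λ a b → a :+ (b :+ b) := a :+ (b :+ (b :+ con 0ℚ))) refl
  rhs : ∀ a c → a ℚ.+ (a ℚ.+ c) ≡ c ℚ.+ (a ℚ.+ (a ℚ.+ 0ℚ))
  rhs = solve 2 (λ a c → a :+ (a :+ c) := c :+ (a :+ (a :+ con 0ℚ))) refl

-- Discrete convexity

ConvexOn : ℕ → (ℕ → ℚ) → Set
ConvexOn M f = ∀ x → suc (suc x) ≤ M → f (suc x) ℚ.- f x ℚ.≤ f (suc (suc x)) ℚ.- f (suc x)

module _ {M : ℕ} {f : ℕ → ℚ} (convex : ConvexOn M f) where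

  increment-mono : ∀ {a c} → a ≤ c → suc c ≤ M → f (suc a) ℚ.- f a ℚ.≤ f (suc c) ℚ.- f c
  increment-mono {c = zero} z≤n _ = ℚ.≤-refl
  increment-mono {a} {suc c} a≤1+c 2+c≤M with ℕ.m≤n⇒m<n∨m≡n a≤1+c
  ... | inj₂ refl      = ℚ.≤-refl
  ... | inj₁ (s≤s a≤c) = ℚ.≤-trans (increment-mono a≤c (ℕ.<⇒≤ 2+c≤M)) (convex c 2+c≤M)

  stride-increment-mono : ∀ k {a c} → a ≤ c → k + c ≤ M → f (k + a) ℚ.- f a ℚ.≤ f (k + c) ℚ.- f c
  stride-increment-mono zero {a} {c} _ _ =
    ℚ.≤-reflexive (trans (ℚ.+-inverseʳ (f a)) (sym (ℚ.+-inverseʳ (f c))))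
  stride-increment-mono (suc k) {a} {c} a≤c 1+k+c≤M =
    subst₂ ℚ._≤_ (telescope (f (suc k + a)) (f (k + a)) (f a)) (telescope (f (suc k + c)) (f (k + c)) (f c))
      (ℚ.+-mono-≤ (increment-mono (ℕ.+-monoʳ-≤ k a≤c) 1+k+c≤M)
                  (stride-increment-mono k a≤c (ℕ.<⇒≤ 1+k+c≤M)))
    where
    open ℚ-Solver
    telescope : ∀ p q r → p ℚ.- q ℚ.+ (q ℚ.- r) ≡ p ℚ.- r
    telescope = solve 3 (λ p q r → p :- q :+ (q :- r) := p :- r) refl

  midpoint-convex : ∀ x → suc (suc x) ≤ M → f (suc x) ℚ.+ f (suc x) ℚ.≤ f x ℚ.+ f (suc (suc x))
  midpoint-convex x 2+x≤M =
    p-q≤r-s⇒p+s≤q+r {f (suc x)} {f x} {f (suc (suc x))} {f (suc x)} (convex x 2+x≤M)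

scale : ℕ → (ℕ → ℚ) → ℕ → ℚ
scale h f u = f (u ℕ.* h)

ConvexOn-scale : ∀ {m M f} h → M ℕ.* h ≤ m → ConvexOn m f → ConvexOn M (scale h f)
ConvexOn-scale {f = f} h Mh≤m convex u 2+u≤M =
  stride-increment-mono {f = f} convex h (ℕ.m≤n+m (u ℕ.* h) h) (ℕ.≤-trans (ℕ.*-monoˡ-≤ h 2+u≤M) Mh≤m)

approachUp approachDown : ℕ → ℕ → ℕ
approachUp a b with a <? b
... | yes _ = suc a
... | no  _ = a
approachDown a b with a <? b
... | yes _ = b ∸ 1
... | no  _ = b

approach-exchange-convex : ∀ {M f} → ConvexOn M f → ∀ a {b} → b ≤ M →
  sumℚ (List.map f (approachUp a b ∷ approachDown a b ∷ [])) ℚ.≤ sumℚ (List.map f (a ∷ b ∷ []))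
approach-exchange-convex {f = f} convex a {b} b≤M with a <? b
... | no  _ = ℚ.≤-refl
... | yes (s≤s {n = c} a≤c) rewrite ℚ.+-identityʳ (f c) | ℚ.+-identityʳ (f (suc c)) =
  p-q≤r-s⇒p+s≤q+r {f (suc a)} {f a} {f (suc c)} {f c} (increment-mono {f = f} convex a≤c b≤M)

∸-exchange-up : ∀ {a a′ b′ c} → b′ ≤ a′ → a ≤ c →
  (suc a ∸ a′) + (c ∸ b′) ≤ (a ∸ a′) + (suc c ∸ b′)
∸-exchange-up {a} {a′} {b′} {c} b′≤a′ a≤c with ℕ.≤-<-connex a′ a
... | inj₁ a′≤a
  rewrite ℕ.+-∸-assoc 1 a′≤a | ℕ.+-∸-assoc 1 (ℕ.≤-trans b′≤a′ (ℕ.≤-trans a′≤a a≤c)) =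
  ℕ.≤-reflexive (sym (ℕ.+-suc (a ∸ a′) (c ∸ b′)))
... | inj₂ a<a′ rewrite ℕ.m≤n⇒m∸n≡0 a<a′ | ℕ.m≤n⇒m∸n≡0 (ℕ.<⇒≤ a<a′) =
  ℕ.∸-monoˡ-≤ b′ (ℕ.n≤1+n c)

∸-exchange-down : ∀ {a a′ b c′} → a′ ≤ c′ → b ≤ a →
  (a ∸ suc a′) + (b ∸ c′) ≤ (a ∸ a′) + (b ∸ suc c′)
∸-exchange-down {a} {a′} {b} {c′} a′≤c′ b≤a with ℕ.≤-<-connex b c′
... | inj₁ b≤c′ rewrite ℕ.m≤n⇒m∸n≡0 b≤c′ | ℕ.m≤n⇒m∸n≡0 (ℕ.m≤n⇒m≤1+n b≤c′) =
  ℕ.+-monoˡ-≤ 0 (ℕ.∸-monoʳ-≤ a (ℕ.n≤1+n a′))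
∸-exchange-down {suc a₀} {a′} {suc b₀} {c′} a′≤c′ (s≤s b₀≤a₀) | inj₂ (s≤s c′≤b₀)
  rewrite ℕ.+-∸-assoc 1 c′≤b₀
        | ℕ.+-∸-assoc 1 (ℕ.≤-trans a′≤c′ (ℕ.≤-trans c′≤b₀ b₀≤a₀)) =
  ℕ.≤-reflexive (ℕ.+-suc (a₀ ∸ a′) (b₀ ∸ c′))

approach-exchange-∸ : ∀ a b a′ b′ →
  sum ((approachUp a b ∸ approachUp a′ b′) ∷ (approachDown a b ∸ approachDown a′ b′) ∷ []) ≤
  sum ((a ∸ a′) ∷ (b ∸ b′) ∷ [])
approach-exchange-∸ a b a′ b′ with a′ <? b′ | a <? b
... | no  _ | no  _ = ℕ.≤-refl
... | yes (s≤s _) | yes (s≤s _) = ℕ.≤-refl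
... | no a′≮b′ | yes (s≤s {n = c} a≤c)
  rewrite ℕ.+-identityʳ (c ∸ b′) | ℕ.+-identityʳ (suc c ∸ b′) =
  ∸-exchange-up (ℕ.≮⇒≥ a′≮b′) a≤c
... | yes (s≤s {n = c′} a′≤c′) | no a≮b
  rewrite ℕ.+-identityʳ (b ∸ c′) | ℕ.+-identityʳ (b ∸ suc c′) =
  ∸-exchange-down a′≤c′ (ℕ.≮⇒≥ a≮b)

approachUp-⊔ : ∀ a b → approachUp a b ⊔ b ≡ a ⊔ b
approachUp-⊔ a b with a <? b
... | yes a<b = trans (ℕ.m≤n⇒m⊔n≡n a<b) (sym (ℕ.m≤n⇒m⊔n≡n (ℕ.<⇒≤ a<b)))
... | no  _   = refl

approachDown-⊓ : ∀ a b → approachDown a b ⊓ a ≡ b ⊓ a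
approachDown-⊓ a zero with a <? zero
... | no  _ = refl
approachDown-⊓ a (suc b) with a <? suc b
... | yes (s≤s a≤b) = trans (ℕ.m≥n⇒m⊓n≡n a≤b) (sym (ℕ.m≥n⇒m⊓n≡n (ℕ.m≤n⇒m≤1+n a≤b)))
... | no  _         = refl

approachUp-≤ : ∀ {a b M} → a ≤ M → b ≤ M → approachUp a b ≤ M
approachUp-≤ {a} {b} a≤M b≤M with a <? b
... | yes a<b = ℕ.≤-trans a<b b≤M
... | no  _   = a≤M

approachDown-≤ : ∀ a b → approachDown a b ≤ b
approachDown-≤ a b with a <? b
... | yes _ = ℕ.m∸n≤m b 1
... | no  _ = ℕ.≤-refl

approachUp-gap : ∀ a b {n} → b ∸ a ≤ suc n → b ∸ approachUp a b ≤ n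
approachUp-gap a b {n} gap with a <? b
... | yes _   = subst (_≤ n) (ℕ.pred[m∸n]≡m∸[1+n] b a) (ℕ.pred-mono-≤ gap)
... | no  a≮b = subst (_≤ n) (sym (ℕ.m≤n⇒m∸n≡0 (ℕ.≮⇒≥ a≮b))) z≤n

approachDown-gap : ∀ a b {n} → b ∸ a ≤ suc n → approachDown a b ∸ a ≤ n
approachDown-gap a b {n} gap with a <? b
... | yes _   =
  subst (_≤ n) (trans (ℕ.pred[m∸n]≡m∸[1+n] b a) (sym (ℕ.∸-+-assoc b 1 a))) (ℕ.pred-mono-≤ gap)
... | no  a≮b = subst (_≤ n) (sym (ℕ.m≤n⇒m∸n≡0 (ℕ.≮⇒≥ a≮b))) z≤n

-- t ↦ (2a − t)⁺ is affine on [2b, 2b + 2] because its kink 2a is even.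
even-∸-midpoint : ∀ a b →
  (a ℕ.* 2 ∸ suc (suc (b ℕ.* 2))) + (a ℕ.* 2 ∸ b ℕ.* 2) ≡
  (a ℕ.* 2 ∸ suc (b ℕ.* 2)) + (a ℕ.* 2 ∸ suc (b ℕ.* 2))
even-∸-midpoint zero    b       rewrite ℕ.0∸n≡0 (b ℕ.* 2) = refl
even-∸-midpoint (suc a) zero    = ℕ.+-suc (a ℕ.* 2) (suc (a ℕ.* 2))
even-∸-midpoint (suc a) (suc b) = even-∸-midpoint a b

three-point-rearrange : ∀ A B C → A + B ≡ C + C → sum (A ∷ B ∷ B ∷ []) ≡ sum (B ∷ C ∷ C ∷ [])
three-point-rearrange A B C eq = begin
  A + (B + (B + 0)) ≡⟨ cong (λ n → A + (B + n)) (ℕ.+-identityʳ B) ⟩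
  A + (B + B)       ≡⟨ ℕ.+-assoc A B B ⟨
  A + B + B         ≡⟨ cong (_+ B) eq ⟩
  C + C + B         ≡⟨ ℕ.+-comm (C + C) B ⟩
  B + (C + C)       ≡⟨ cong (λ n → B + (C + n)) (ℕ.+-identityʳ C) ⟨
  B + (C + (C + 0)) ∎
  where open ≡-Reasoning

even-∸-three-point : ∀ a b →
  sum ((a ℕ.* 2 ∸ suc (suc (b ℕ.* 2))) ∷ (a ℕ.* 2 ∸ b ℕ.* 2) ∷ (a ℕ.* 2 ∸ b ℕ.* 2) ∷ []) ≡
  sum ((a ℕ.* 2 ∸ b ℕ.* 2) ∷ (a ℕ.* 2 ∸ suc (b ℕ.* 2)) ∷ (a ℕ.* 2 ∸ suc (b ℕ.* 2)) ∷ [])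
even-∸-three-point a b =
  three-point-rearrange (a ℕ.* 2 ∸ suc (suc (b ℕ.* 2))) (a ℕ.* 2 ∸ b ℕ.* 2) (a ℕ.* 2 ∸ suc (b ℕ.* 2))
    (even-∸-midpoint a b)

even-∸-three-point′ : ∀ a b →
  sum ((suc a ℕ.* 2 ∸ b ℕ.* 2) ∷ (a ℕ.* 2 ∸ b ℕ.* 2) ∷ (a ℕ.* 2 ∸ b ℕ.* 2) ∷ []) ≡
  sum ((a ℕ.* 2 ∸ b ℕ.* 2) ∷ (suc (a ℕ.* 2) ∸ b ℕ.* 2) ∷ (suc (a ℕ.* 2) ∸ b ℕ.* 2) ∷ [])
even-∸-three-point′ a b =
  three-point-rearrange (suc a ℕ.* 2 ∸ b ℕ.* 2) (a ℕ.* 2 ∸ b ℕ.* 2) (suc (a ℕ.* 2) ∸ b ℕ.* 2)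
    (trans (ℕ.+-comm (suc a ℕ.* 2 ∸ b ℕ.* 2) (a ℕ.* 2 ∸ b ℕ.* 2)) (even-∸-midpoint (suc a) b))

-- The schedules of a list are the maps φ of one vector I of profiles; the previous profile p
-- is nothing before the first slot, where every schedule starts from x₀ = 0.
module _ (β : ℚ) .{{_ : ℚ.NonNegative β}} where

  sumℚ-split : ∀ {B : Set} (bs : List B) (F G : B → ℚ) (N : B → ℕ) →
    sumℚ (List.map (λ b → F b ℚ.+ β ℚ.* ℕ→ℚ (N b) ℚ.+ G b) bs) ≡
    sumℚ (List.map F bs) ℚ.+ β ℚ.* ℕ→ℚ (sum (List.map N bs)) ℚ.+ sumℚ (List.map G bs)
  sumℚ-split [] F G N = solve 1 (λ β → con 0ℚ := con 0ℚ :+ β :* con 0ℚ :+ con 0ℚ) refl β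
    where open ℚ-Solver
  sumℚ-split (b ∷ bs) F G N rewrite sumℚ-split bs F G N | ℕ→ℚ-+ (N b) (sum (List.map N bs)) =
    solve 7 (λ β f n g fs ns gs → f :+ β :* n :+ g :+ (fs :+ β :* ns :+ gs) :=
                                  f :+ fs :+ β :* (n :+ ns) :+ (g :+ gs))
      refl β (F b) (ℕ→ℚ (N b)) (G b)
      (sumℚ (List.map F bs)) (ℕ→ℚ (sum (List.map N bs))) (sumℚ (List.map G bs))
    where open ℚ-Solver

  module _ {A : Set} {P : A → Set} {Q : (ℕ → ℚ) → Set} (φs ψs : List (A → ℕ))
    (slot : ∀ {f a} → Q f → P a →
      sumℚ (List.map (λ φ → f (φ a)) φs) ℚ.≤ sumℚ (List.map (λ ψ → f (ψ a)) ψs))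
    (switch : ∀ {p a} → Maybe.All P p → P a →
      sum (List.map (λ φ → φ a ∸ maybe′ φ 0 p) φs) ≤ sum (List.map (λ ψ → ψ a ∸ maybe′ ψ 0 p) ψs))
    where

    costFrom-sum-mono : ∀ {T} {fs : Vec (ℕ → ℚ) T} {I : Vec A T} {p} →
      All Q fs → All P I → Maybe.All P p →
      sumℚ (List.map (λ φ → costFrom β (maybe′ φ 0 p) fs (Vec.map φ I)) φs) ℚ.≤
      sumℚ (List.map (λ ψ → costFrom β (maybe′ ψ 0 p) fs (Vec.map ψ I)) ψs)
    costFrom-sum-mono [] [] _ = ℚ.≤-reflexive (trans (sumℚ-const-0 φs) (sym (sumℚ-const-0 ψs)))
    costFrom-sum-mono {fs = f ∷ fs} {I = a ∷ I} {p} (qf ∷ qfs) (pa ∷ pI) pp =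
      subst₂ ℚ._≤_
        (sym (sumℚ-split φs (λ φ → f (φ a)) (λ φ → costFrom β (φ a) fs (Vec.map φ I))
                            (λ φ → φ a ∸ maybe′ φ 0 p)))
        (sym (sumℚ-split ψs (λ ψ → f (ψ a)) (λ ψ → costFrom β (ψ a) fs (Vec.map ψ I))
                            (λ ψ → ψ a ∸ maybe′ ψ 0 p)))
        (ℚ.+-mono-≤ (ℚ.+-mono-≤ (slot qf pa) (ℚ.*-monoˡ-≤-nonNeg β (ℕ→ℚ-mono-≤ (switch pp pa))))
                    (costFrom-sum-mono qfs pI (Maybe.just pa)))

-- Pushing a schedule into the band around an even schedule

-- A profile (y , x) pairs an entry of a schedule Y with the entry of an even schedule X.
-- With Z = X ∸ 1 and A = {t | y < z}: liftY = Y + χ_A, dropZ = Z − χ_A, dropX = X − 2χ_A.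
-- With Z = X + 1 and B = {t | z < y}: dropY = Y − χ_B, liftZ = Z + χ_B, liftX = X + 2χ_B.
belowX aboveX liftY dropY dropZ liftZ dropX liftX : ℕ × ℕ → ℕ
belowX (_ , x) = x ∸ 1
aboveX (_ , x) = suc x
liftY (y , x) = approachUp y (x ∸ 1)
dropY (y , x) = approachDown (suc x) y
dropZ (y , x) = approachDown y (x ∸ 1)
liftZ (y , x) = approachUp (suc x) y
dropX (y , x) with y <? x ∸ 1
... | yes _ = x ∸ 2
... | no  _ = x
liftX (y , x) with suc x <? y
... | yes _ = suc (suc x)
... | no  _ = x

dropX-three-point-convex : ∀ {M f} → ConvexOn M f → ∀ y {x} → x ≤ M →
  sumℚ (List.map f (dropX (y , x) ∷ x ∸ 1 ∷ x ∸ 1 ∷ [])) ℚ.≤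
  sumℚ (List.map f (x ∷ dropZ (y , x) ∷ dropZ (y , x) ∷ []))
dropX-three-point-convex convex y {x} x≤M with y <? x ∸ 1
... | no _ = ℚ.≤-refl
dropX-three-point-convex {f = f} convex y {suc (suc u)} x≤M | yes _ =
  three-point-convex (f u) (f (suc u)) (f (suc (suc u))) (midpoint-convex {f = f} convex u x≤M)

liftX-three-point-convex : ∀ {M f} → ConvexOn M f → ∀ {y} x → y ≤ M →
  sumℚ (List.map f (liftX (y , x) ∷ suc x ∷ suc x ∷ [])) ℚ.≤
  sumℚ (List.map f (x ∷ liftZ (y , x) ∷ liftZ (y , x) ∷ []))
liftX-three-point-convex {f = f} convex {y} x y≤M with suc x <? y
... | no _ = ℚ.≤-refl
... | yes 2+x≤y =
  three-point-convex (f (suc (suc x))) (f (suc x)) (f x)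
    (subst (f (suc x) ℚ.+ f (suc x) ℚ.≤_) (ℚ.+-comm (f x) (f (suc (suc x))))
      (midpoint-convex {f = f} convex x (ℕ.≤-trans 2+x≤y y≤M)))

dropX-three-point-∸ : ∀ py y b a →
  sum ((dropX (y , a ℕ.* 2) ∸ dropX (py , b ℕ.* 2)) ∷
       (a ℕ.* 2 ∸ 1 ∸ (b ℕ.* 2 ∸ 1)) ∷ (a ℕ.* 2 ∸ 1 ∸ (b ℕ.* 2 ∸ 1)) ∷ []) ≡
  sum ((a ℕ.* 2 ∸ b ℕ.* 2) ∷
       (dropZ (y , a ℕ.* 2) ∸ dropZ (py , b ℕ.* 2)) ∷ (dropZ (y , a ℕ.* 2) ∸ dropZ (py , b ℕ.* 2)) ∷ [])
dropX-three-point-∸ py y b a with py <? b ℕ.* 2 ∸ 1 | y <? a ℕ.* 2 ∸ 1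
... | no _ | no _ = refl
dropX-three-point-∸ py y zero    _       | yes () | _
dropX-three-point-∸ py y _       zero    | _      | yes ()
dropX-three-point-∸ py y (suc b) (suc a) | yes _  | yes _ = refl
dropX-three-point-∸ py y zero    (suc a) | no _   | yes _ = solve 1 (λ n →
  n :+ ((con 1 :+ n) :+ ((con 1 :+ n) :+ con 0)) := (con 2 :+ n) :+ (n :+ (n :+ con 0))) refl (a ℕ.* 2)
  where open ℕ-Solver
dropX-three-point-∸ py y (suc b) (suc a) | no _   | yes _ = even-∸-three-point a b
dropX-three-point-∸ py y (suc b) zero    | yes _  | no _ rewrite ℕ.0∸n≡0 (b ℕ.* 2) = refl
dropX-three-point-∸ py y (suc b) (suc a) | yes _  | no _ = even-∸-three-point′ a b

liftX-three-point-∸ : ∀ py y b a →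
  sum ((liftX (y , a ℕ.* 2) ∸ liftX (py , b ℕ.* 2)) ∷
       (suc (a ℕ.* 2) ∸ suc (b ℕ.* 2)) ∷ (suc (a ℕ.* 2) ∸ suc (b ℕ.* 2)) ∷ []) ≡
  sum ((a ℕ.* 2 ∸ b ℕ.* 2) ∷
       (liftZ (y , a ℕ.* 2) ∸ liftZ (py , b ℕ.* 2)) ∷ (liftZ (y , a ℕ.* 2) ∸ liftZ (py , b ℕ.* 2)) ∷ [])
liftX-three-point-∸ py y b a with suc (b ℕ.* 2) <? py | suc (a ℕ.* 2) <? y
... | no _  | no _  = refl
... | yes _ | yes _ = refl
... | no _  | yes _ = even-∸-three-point′ a b
... | yes _ | no _  = even-∸-three-point a b

liftX-three-point-∸-start : ∀ y x →
  sum ((liftX (y , x) ∸ 0) ∷ (suc x ∸ 0) ∷ (suc x ∸ 0) ∷ []) ≡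
  sum ((x ∸ 0) ∷ (liftZ (y , x) ∸ 0) ∷ (liftZ (y , x) ∸ 0) ∷ [])
liftX-three-point-∸-start y x with suc x <? y
... | no _  = refl
... | yes _ = solve 1 (λ n →
  (con 2 :+ n) :+ ((con 1 :+ n) :+ ((con 1 :+ n) :+ con 0)) := n :+ ((con 2 :+ n) :+ ((con 2 :+ n) :+ con 0)))
  refl x
  where open ℕ-Solver

liftStep dropStep : ℕ × ℕ → ℕ × ℕ
liftStep p = liftY p , proj₂ p
dropStep p = dropY p , proj₂ p

gapBelowBand gapAboveBand : ℕ × ℕ → ℕ
gapBelowBand (y , x) = x ∸ 1 ∸ y
gapAboveBand (y , x) = y ∸ suc x

raiseToBand lowerToBand clampToBand : ℕ × ℕ → ℕ
raiseToBand (y , x) = y ⊔ (x ∸ 1)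
lowerToBand (y , x) = y ⊓ suc x
clampToBand (y , x) = (y ⊔ (x ∸ 1)) ⊓ suc x

raisedProfile : ℕ × ℕ → ℕ × ℕ
raisedProfile p = raiseToBand p , proj₂ p

clampToBand-lower : ∀ p → proj₂ p ≤ suc (clampToBand p)
clampToBand-lower (y , x) =
  ℕ.⊓-glb (ℕ.≤-trans (ℕ.m≤n+m∸n x 1) (s≤s (ℕ.m≤n⊔m y (x ∸ 1)))) (ℕ.m≤n⇒m≤1+n (ℕ.n≤1+n x))

clampToBand-upper : ∀ p → clampToBand p ≤ suc (proj₂ p)
clampToBand-upper (y , x) = ℕ.m⊓n≤n (y ⊔ (x ∸ 1)) (suc x)

clampToBand-≤ : ∀ {M y x} → y ≤ M → x ≤ M → clampToBand (y , x) ≤ M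
clampToBand-≤ {y = y} {x} y≤M x≤M =
  ℕ.≤-trans (ℕ.m⊓n≤m (y ⊔ (x ∸ 1)) (suc x)) (ℕ.⊔-lub y≤M (ℕ.≤-trans (ℕ.m∸n≤m x 1) x≤M))

map-cong-All : ∀ {A B : Set} {f g : A → B} {n} {xs : Vec A n} →
  All (λ x → f x ≡ g x) xs → Vec.map f xs ≡ Vec.map g xs
map-cong-All []         = refl
map-cong-All (eq ∷ eqs) = cong₂ _∷_ eq (map-cong-All eqs)

module Proximity (β : ℚ) .{{_ : ℚ.NonNegative β}} (M : ℕ) {T : ℕ} (fs : Vec (ℕ → ℚ) T)
                 (convex : All (ConvexOn M) fs) where

  C : Vec ℕ T → ℚ
  C = cost β fs

  EvenOptimal : Vec ℕ T → Set
  EvenOptimal = MinCostAmong β fs (λ _ x → x ≤ M × 2 ∣ x)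

  Admissible : ℕ × ℕ → Set
  Admissible (y , x) = y ≤ M × x ≤ M × 2 ∣ x

  dropX-even : ∀ {p} → Admissible p → dropX p ≤ M × 2 ∣ dropX p
  dropX-even {y , x} (_ , x≤M , divides k refl) with y <? x ∸ 1
  ... | yes _ = ℕ.≤-trans (ℕ.m∸n≤m x 2) x≤M , divides (k ∸ 1) (sym (ℕ.*-distribʳ-∸ 2 k 1))
  ... | no  _ = x≤M , divides k refl

  liftX-even : ∀ {p} → Admissible p → liftX p ≤ M × 2 ∣ liftX p
  liftX-even {y , x} (y≤M , x≤M , 2∣x) with suc x <? y
  ... | yes 2+x≤y = ℕ.≤-trans 2+x≤y y≤M , ∣m∣n⇒∣m+n ∣-refl 2∣x
  ... | no  _     = x≤M , 2∣x

  optimal≤even : ∀ {I} (g : ℕ × ℕ → ℕ) → (∀ {p} → Admissible p → g p ≤ M × 2 ∣ g p) →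
    All Admissible I → EvenOptimal (Vec.map proj₂ I) → C (Vec.map proj₂ I) ℚ.≤ C (Vec.map g I)
  optimal≤even {I} g g-even adm opt =
    proj₂ opt (Vec.map g I) λ t →
      subst (λ v → v ≤ M × 2 ∣ v) (sym (Vec.lookup-map t g I)) (g-even (lookup⁺ adm t))

  liftY-cost : ∀ {I} → All Admissible I → EvenOptimal (Vec.map proj₂ I) →
    C (Vec.map liftY I) ℚ.≤ C (Vec.map proj₁ I)
  liftY-cost {I} adm opt =
    pair-cancelʳ (C∘ liftY) (C∘ dropZ) (C∘ proj₁) (C∘ belowX) exchange
      (triple-cancel (C∘ dropX) (C∘ belowX) (C∘ proj₂) (C∘ dropZ) three-point
        (optimal≤even dropX dropX-even adm opt))
    where
    C∘ : (ℕ × ℕ → ℕ) → ℚ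
    C∘ g = C (Vec.map g I)
    exchange : sumℚ (C∘ liftY ∷ C∘ dropZ ∷ []) ℚ.≤ sumℚ (C∘ proj₁ ∷ C∘ belowX ∷ [])
    exchange = costFrom-sum-mono β (liftY ∷ dropZ ∷ []) (proj₁ ∷ belowX ∷ [])
      (λ { {f} {y , x} cf (_ , x≤M , _) →
             approach-exchange-convex {f = f} cf y (ℕ.≤-trans (ℕ.m∸n≤m x 1) x≤M) })
      (λ { {nothing} {y , x} _ _ → approach-exchange-∸ y (x ∸ 1) 0 0
         ; {just (py , px)} {y , x} _ _ → approach-exchange-∸ y (x ∸ 1) py (px ∸ 1) })
      convex adm Maybe.nothing
    three-point :
      sumℚ (C∘ dropX ∷ C∘ belowX ∷ C∘ belowX ∷ []) ℚ.≤ sumℚ (C∘ proj₂ ∷ C∘ dropZ ∷ C∘ dropZ ∷ [])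
    three-point = costFrom-sum-mono β (dropX ∷ belowX ∷ belowX ∷ []) (proj₂ ∷ dropZ ∷ dropZ ∷ [])
      (λ { {f} {y , x} cf (_ , x≤M , _) → dropX-three-point-convex {f = f} cf y x≤M })
      (λ { {nothing} {y , x} _ (_ , _ , divides a refl) → ℕ.≤-reflexive (dropX-three-point-∸ 0 y 0 a)
         ; {just (py , px)} {y , x} (Maybe.just (_ , _ , divides b refl)) (_ , _ , divides a refl) →
             ℕ.≤-reflexive (dropX-three-point-∸ py y b a) })
      convex adm Maybe.nothing

  dropY-cost : ∀ {I} → All Admissible I → EvenOptimal (Vec.map proj₂ I) →
    C (Vec.map dropY I) ℚ.≤ C (Vec.map proj₁ I)
  dropY-cost {I} adm opt =
    pair-cancelˡ (C∘ liftZ) (C∘ dropY) (C∘ aboveX) (C∘ proj₁) exchange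
      (triple-cancel (C∘ liftX) (C∘ aboveX) (C∘ proj₂) (C∘ liftZ) three-point
        (optimal≤even liftX liftX-even adm opt))
    where
    C∘ : (ℕ × ℕ → ℕ) → ℚ
    C∘ g = C (Vec.map g I)
    exchange : sumℚ (C∘ liftZ ∷ C∘ dropY ∷ []) ℚ.≤ sumℚ (C∘ aboveX ∷ C∘ proj₁ ∷ [])
    exchange = costFrom-sum-mono β (liftZ ∷ dropY ∷ []) (aboveX ∷ proj₁ ∷ [])
      (λ { {f} {y , x} cf (y≤M , _ , _) → approach-exchange-convex {f = f} cf (suc x) y≤M })
      (λ { {nothing} {y , x} _ _ → approach-exchange-∸ (suc x) y 0 0
         ; {just (py , px)} {y , x} _ _ → approach-exchange-∸ (suc x) y (suc px) py })
      convex adm Maybe.nothing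
    three-point :
      sumℚ (C∘ liftX ∷ C∘ aboveX ∷ C∘ aboveX ∷ []) ℚ.≤ sumℚ (C∘ proj₂ ∷ C∘ liftZ ∷ C∘ liftZ ∷ [])
    three-point = costFrom-sum-mono β (liftX ∷ aboveX ∷ aboveX ∷ []) (proj₂ ∷ liftZ ∷ liftZ ∷ [])
      (λ { {f} {y , x} cf (y≤M , _ , _) → liftX-three-point-convex {f = f} cf x y≤M })
      (λ { {nothing} {y , x} _ _ → ℕ.≤-reflexive (liftX-three-point-∸-start y x)
         ; {just (py , px)} {y , x} (Maybe.just (_ , _ , divides b refl)) (_ , _ , divides a refl) →
             ℕ.≤-reflexive (liftX-three-point-∸ py y b a) })
      convex adm Maybe.nothing

  raiseToBand-cost : ∀ n {I} → All Admissible I → All (λ p → gapBelowBand p ≤ n) I →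
    EvenOptimal (Vec.map proj₂ I) → C (Vec.map raiseToBand I) ℚ.≤ C (Vec.map proj₁ I)
  raiseToBand-cost zero {I} _ gaps _ = ℚ.≤-reflexive (cong C (map-cong-All (All.map (λ {p} → no-gap {p}) gaps)))
    where
    no-gap : ∀ {p} → gapBelowBand p ≤ 0 → raiseToBand p ≡ proj₁ p
    no-gap {y , x} gap = ℕ.m≥n⇒m⊔n≡m (ℕ.m∸n≡0⇒m≤n {x ∸ 1} {y} (ℕ.n≤0⇒n≡0 gap))
  raiseToBand-cost (suc n) {I} adm gaps opt = begin
    C (Vec.map raiseToBand I)                    ≡⟨ cong C raise-after-step ⟩
    C (Vec.map raiseToBand (Vec.map liftStep I)) ≤⟨ raiseToBand-cost n adm′ gaps′ opt′ ⟩
    C (Vec.map proj₁ (Vec.map liftStep I))       ≡⟨ cong C (Vec.map-∘ proj₁ liftStep I) ⟨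
    C (Vec.map liftY I)                          ≤⟨ liftY-cost adm opt ⟩
    C (Vec.map proj₁ I)                          ∎
    where
    open ℚ.≤-Reasoning
    raise-after-step : Vec.map raiseToBand I ≡ Vec.map raiseToBand (Vec.map liftStep I)
    raise-after-step = trans (Vec.map-cong (λ (y , x) → sym (approachUp-⊔ y (x ∸ 1))) I)
                             (Vec.map-∘ raiseToBand liftStep I)
    adm′ : All Admissible (Vec.map liftStep I)
    adm′ = map⁺ (All.map (λ {p} (y≤M , x≤M , 2∣x) →
      approachUp-≤ y≤M (ℕ.≤-trans (ℕ.m∸n≤m (proj₂ p) 1) x≤M) , x≤M , 2∣x) adm)
    gaps′ : All (λ p → gapBelowBand p ≤ n) (Vec.map liftStep I)
    gaps′ = map⁺ (All.map (λ {p} → approachUp-gap (proj₁ p) (proj₂ p ∸ 1)) gaps)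
    opt′ : EvenOptimal (Vec.map proj₂ (Vec.map liftStep I))
    opt′ = subst EvenOptimal (Vec.map-∘ proj₂ liftStep I) opt

  lowerToBand-cost : ∀ n {I} → All Admissible I → All (λ p → gapAboveBand p ≤ n) I →
    EvenOptimal (Vec.map proj₂ I) → C (Vec.map lowerToBand I) ℚ.≤ C (Vec.map proj₁ I)
  lowerToBand-cost zero {I} _ gaps _ = ℚ.≤-reflexive (cong C (map-cong-All (All.map (λ {p} → no-gap {p}) gaps)))
    where
    no-gap : ∀ {p} → gapAboveBand p ≤ 0 → lowerToBand p ≡ proj₁ p
    no-gap {y , x} gap = ℕ.m≤n⇒m⊓n≡m (ℕ.m∸n≡0⇒m≤n {y} {suc x} (ℕ.n≤0⇒n≡0 gap))
  lowerToBand-cost (suc n) {I} adm gaps opt = begin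
    C (Vec.map lowerToBand I)                    ≡⟨ cong C lower-after-step ⟩
    C (Vec.map lowerToBand (Vec.map dropStep I)) ≤⟨ lowerToBand-cost n adm′ gaps′ opt′ ⟩
    C (Vec.map proj₁ (Vec.map dropStep I))       ≡⟨ cong C (Vec.map-∘ proj₁ dropStep I) ⟨
    C (Vec.map dropY I)                          ≤⟨ dropY-cost adm opt ⟩
    C (Vec.map proj₁ I)                          ∎
    where
    open ℚ.≤-Reasoning
    lower-after-step : Vec.map lowerToBand I ≡ Vec.map lowerToBand (Vec.map dropStep I)
    lower-after-step = trans (Vec.map-cong (λ (y , x) → sym (approachDown-⊓ (suc x) y)) I)
                             (Vec.map-∘ lowerToBand dropStep I)
    adm′ : All Admissible (Vec.map dropStep I)
    adm′ = map⁺ (All.map (λ {p} (y≤M , x≤M , 2∣x) →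
      ℕ.≤-trans (approachDown-≤ (suc (proj₂ p)) (proj₁ p)) y≤M , x≤M , 2∣x) adm)
    gaps′ : All (λ p → gapAboveBand p ≤ n) (Vec.map dropStep I)
    gaps′ = map⁺ (All.map (λ {p} → approachDown-gap (suc (proj₂ p)) (proj₁ p)) gaps)
    opt′ : EvenOptimal (Vec.map proj₂ (Vec.map dropStep I))
    opt′ = subst EvenOptimal (Vec.map-∘ proj₂ dropStep I) opt

  clampToBand-cost : ∀ {I} → All Admissible I → EvenOptimal (Vec.map proj₂ I) →
    C (Vec.map clampToBand I) ℚ.≤ C (Vec.map proj₁ I)
  clampToBand-cost {I} adm opt = begin
    C (Vec.map clampToBand I)                         ≡⟨ cong C (Vec.map-∘ lowerToBand raisedProfile I) ⟩
    C (Vec.map lowerToBand (Vec.map raisedProfile I)) ≤⟨ lowerToBand-cost M adm₁ gaps₁ opt₁ ⟩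
    C (Vec.map proj₁ (Vec.map raisedProfile I))       ≡⟨ cong C (Vec.map-∘ proj₁ raisedProfile I) ⟨
    C (Vec.map raiseToBand I)                         ≤⟨ raiseToBand-cost M adm gaps opt ⟩
    C (Vec.map proj₁ I)                               ∎
    where
    open ℚ.≤-Reasoning
    x∸1≤M : ∀ {x} → x ≤ M → x ∸ 1 ≤ M
    x∸1≤M {x} x≤M = ℕ.≤-trans (ℕ.m∸n≤m x 1) x≤M
    gaps : All (λ p → gapBelowBand p ≤ M) I
    gaps = All.map (λ {p} (_ , x≤M , _) →
      ℕ.≤-trans (ℕ.m∸n≤m (proj₂ p ∸ 1) (proj₁ p)) (x∸1≤M x≤M)) adm
    adm₁ : All Admissible (Vec.map raisedProfile I)
    adm₁ = map⁺ (All.map (λ (y≤M , x≤M , 2∣x) → ℕ.⊔-lub y≤M (x∸1≤M x≤M) , x≤M , 2∣x) adm)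
    gaps₁ : All (λ p → gapAboveBand p ≤ M) (Vec.map raisedProfile I)
    gaps₁ = map⁺ (All.map (λ {p} (y≤M , x≤M , _) →
      ℕ.≤-trans (ℕ.m∸n≤m (raiseToBand p) (suc (proj₂ p))) (ℕ.⊔-lub y≤M (x∸1≤M x≤M))) adm)
    opt₁ : EvenOptimal (Vec.map proj₂ (Vec.map raisedProfile I))
    opt₁ = subst EvenOptimal (Vec.map-∘ proj₂ raisedProfile I) opt

costFrom-scale : ∀ β h {T} (fs : Vec (ℕ → ℚ) T) (V : Vec ℕ T) p →
  costFrom β (p ℕ.* h) fs (Vec.map (ℕ._* h) V) ≡ costFrom (β ℚ.* ℕ→ℚ h) p (Vec.map (scale h) fs) V
costFrom-scale β h []       []      p = refl
costFrom-scale β h (f ∷ fs) (v ∷ V) p =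
  cong₂ (λ s c → f (v ℕ.* h) ℚ.+ s ℚ.+ c) switching (costFrom-scale β h fs V v)
  where
  open ≡-Reasoning
  switching : β ℚ.* ℕ→ℚ (v ℕ.* h ∸ p ℕ.* h) ≡ β ℚ.* ℕ→ℚ h ℚ.* ℕ→ℚ (v ∸ p)
  switching = begin
    β ℚ.* ℕ→ℚ (v ℕ.* h ∸ p ℕ.* h)  ≡⟨ cong (λ n → β ℚ.* ℕ→ℚ n) (ℕ.*-distribʳ-∸ h v p) ⟨
    β ℚ.* ℕ→ℚ ((v ∸ p) ℕ.* h)      ≡⟨ cong (β ℚ.*_) (ℕ→ℚ-* (v ∸ p) h) ⟩
    β ℚ.* (ℕ→ℚ (v ∸ p) ℚ.* ℕ→ℚ h)  ≡⟨ rearrange β (ℕ→ℚ (v ∸ p)) (ℕ→ℚ h) ⟩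
    β ℚ.* ℕ→ℚ h ℚ.* ℕ→ℚ (v ∸ p)    ∎
    where
    open ℚ-Solver
    rearrange : ∀ β a b → β ℚ.* (a ℚ.* b) ≡ β ℚ.* b ℚ.* a
    rearrange = solve 3 (λ β a b → β :* (a :* b) := β :* b :* a) refl

cost-scale : ∀ β h {T} (fs : Vec (ℕ → ℚ) T) (V : Vec ℕ T) →
  cost β fs (Vec.map (ℕ._* h) V) ≡ cost (β ℚ.* ℕ→ℚ h) (Vec.map (scale h) fs) V
cost-scale β h fs V = costFrom-scale β h fs V 0

OnGrid : ℕ → ℕ → ℕ → Set
OnGrid m j x = x ≤ m × 2 ^ j ∣ x

OnGrid-0⇔≤ : ∀ {m x} → OnGrid m 0 x ⇔ x ≤ m
OnGrid-0⇔≤ {x = x} = mk⇔ proj₁ (λ x≤m → x≤m , 1∣ x)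

2^[K+2]≡4*2^K : ∀ K → 2 ^ (K + 2) ≡ 4 ℕ.* 2 ^ K
2^[K+2]≡4*2^K K = trans (ℕ.^-distribˡ-+-* 2 K 2) (ℕ.*-comm (2 ^ K) 4)

CoarseGrid⇔OnGrid : ∀ K {x} → CoarseGrid K x ⇔ OnGrid (2 ^ (K + 2)) K x
CoarseGrid⇔OnGrid K = mk⇔
  (λ { (ξ , ξ≤4 , refl) →
         subst (ξ ℕ.* 2 ^ K ≤_) (sym (2^[K+2]≡4*2^K K)) (ℕ.*-monoˡ-≤ (2 ^ K) ξ≤4) , divides ξ refl })
  (λ { (x≤m , divides ξ refl) →
         ξ , ℕ.*-cancelʳ-≤ ξ 4 (2 ^ K) {{ℕ.m^n≢0 2 K}} (subst (ξ ℕ.* 2 ^ K ≤_) (2^[K+2]≡4*2^K K) x≤m) ,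
         refl })

Nbhd⇒OnGrid : ∀ {m j x̂ x} → 2 ^ j ∣ x̂ → Nbhd m j x̂ x → OnGrid m j x
Nbhd⇒OnGrid {j = j} {x̂} h∣x̂ (x≤m , ξ , _ , x≡x̂+ξh) =
  x≤m , ℤ∣.∣⇒∣ᵤ (subst (ℤ∣._∣_ (+ 2 ^ j)) (sym x≡x̂+ξh) h∣x̂+ξh)
  where
  h∣x̂+ξh : ℤ∣._∣_ (+ 2 ^ j) (+ x̂ ℤ.+ ξ ℤ.* + 2 ^ j)
  h∣x̂+ξh = ℤ∣.∣m∣n⇒∣m+n (ℤ∣.∣ᵤ⇒∣ {i = + x̂} h∣x̂) (ℤ∣.∣n⇒∣m*n ξ ℤ∣.∣-refl)

Nbhd-band : ∀ {m j w c} → c ℕ.* 2 ^ j ≤ m → w ≤ suc c → c ≤ suc w →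
  Nbhd m j (w ℕ.* 2 ^ j) (c ℕ.* 2 ^ j)
Nbhd-band {m} {j} {w} {c} c≤m w≤1+c c≤1+w = c≤m , c ⊖ w , (lower , upper) , identity
  where
  lower : ℤ.- (+ 2) ℤ.≤ c ⊖ w
  lower = ℤ.≤-trans (ℤ.-≤- z≤n)
    (subst (ℤ._≤ c ⊖ w) (trans (ℤ.⊖-≤ (ℕ.n≤1+n c)) (cong (λ n → ℤ.- + n) (ℕ.m+n∸n≡m 1 c)))
      (ℤ.⊖-monoʳ-≥-≤ c w≤1+c))
  upper : c ⊖ w ℤ.≤ + 2
  upper = ℤ.≤-trans
    (subst (c ⊖ w ℤ.≤_) (trans (ℤ.⊖-≥ (ℕ.n≤1+n w)) (cong +_ (ℕ.m+n∸n≡m 1 w)))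
      (ℤ.⊖-monoˡ-≤ w c≤1+w))
    (ℤ.+≤+ (s≤s z≤n))
  identity : + (c ℕ.* 2 ^ j) ≡ + (w ℕ.* 2 ^ j) ℤ.+ (c ⊖ w) ℤ.* + 2 ^ j
  identity rewrite ℤ.pos-* c (2 ^ j) | ℤ.pos-* w (2 ^ j) | sym (ℤ.[+m]-[+n]≡m⊖n c w) =
    solve 3 (λ c w h → c :* h := w :* h :+ (c :- w) :* h) refl (+ c) (+ w) (+ 2 ^ j)
    where open ℤ-Solver

module _ (β : ℚ) {T : ℕ} (fs : Vec (ℕ → ℚ) T) (S S′ : Fin T → ℕ → Set) where

  MinCostAmong-dominated : (∀ {t x} → S t x → S′ t x) →
    (∀ Y → (∀ t → S′ t (lookup Y t)) →
       ∃[ Y′ ] (∀ t → S t (lookup Y′ t)) × cost β fs Y′ ℚ.≤ cost β fs Y) →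
    ∀ {X} → MinCostAmong β fs S X → MinCostAmong β fs S′ X
  MinCostAmong-dominated S⊆S′ dominated (X∈S , X-min) =
    (λ t → S⊆S′ (X∈S t)) ,
    λ Y Y∈S′ → let (Y′ , Y′∈S , Y′≤Y) = dominated Y Y∈S′ in ℚ.≤-trans (X-min Y′ Y′∈S) Y′≤Y

  MinCostAmong-cong : (∀ {t x} → S t x ⇔ S′ t x) →
    ∀ {X} → MinCostAmong β fs S X → MinCostAmong β fs S′ X
  MinCostAmong-cong S⇔S′ =
    MinCostAmong-dominated (Equivalence.to S⇔S′)
      (λ Y Y∈S′ → Y , (λ t → Equivalence.from S⇔S′ (Y∈S′ t)) , ℚ.≤-refl)

-- One iteration of the procedure

module Refinement (β : ℚ) .{{_ : ℚ.NonNegative β}} {T : ℕ} (fs : Vec (ℕ → ℚ) T) {m : ℕ}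
                  (convex : Convex m fs) (j : ℕ) where

  h : ℕ
  h = 2 ^ j

  instance
    h≢0 : ℕ.NonZero h
    h≢0 = ℕ.m^n≢0 2 j
    βh≥0 : ℚ.NonNegative (β ℚ.* ℕ→ℚ h)
    βh≥0 = ℚ.nonNeg*nonNeg⇒nonNeg β (ℕ→ℚ h) {{ℚ.nonNegative (ℕ→ℚ-mono-≤ {0} {h} z≤n)}}

  M : ℕ
  M = m / h

  open Proximity (β ℚ.* ℕ→ℚ h) M (Vec.map (scale h) fs)
    (map⁺ (All.map (λ {f} → ConvexOn-scale {f = f} h (m/n*n≤m m h)) (lookup⁻ convex)))

  unscale : ∀ {n} {Y : Vec ℕ n} → All (h ∣_) Y → Vec.map (ℕ._* h) (Vec.map (_/ h) Y) ≡ Y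
  unscale []          = refl
  unscale (h∣y ∷ h∣Y) = cong₂ _∷_ (m/n*n≡m h∣y) (unscale h∣Y)

  OnGrid-/ : ∀ {y} → OnGrid m j y → y / h ≤ M
  OnGrid-/ (y≤m , _) = /-monoˡ-≤ h y≤m

  OnGrid-halve : ∀ {x} → OnGrid m (suc j) x → x / h ≤ M × 2 ∣ x / h
  OnGrid-halve {x} (x≤m , 2h∣x) =
    /-monoˡ-≤ h x≤m , *-cancelʳ-∣ h (subst (2 ℕ.* h ∣_) (sym (m/n*n≡m h∣x)) 2h∣x)
    where
    h∣x : h ∣ x
    h∣x = ∣-trans (n∣m*n 2) 2h∣x

  OnGrid-double : ∀ {v} → v ≤ M × 2 ∣ v → OnGrid m (suc j) (v ℕ.* h)
  OnGrid-double (v≤M , 2∣v) = ℕ.≤-trans (ℕ.*-monoˡ-≤ h v≤M) (m/n*n≤m m h) , *-monoˡ-∣ h 2∣v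

  module _ {X : Vec ℕ T} (X-opt : MinCostAmong β fs (λ _ → OnGrid m (suc j)) X) where

    W : Vec ℕ T
    W = Vec.map (_/ h) X

    h∣X : All (h ∣_) X
    h∣X = lookup⁻ (λ t → ∣-trans (n∣m*n 2) (proj₂ (proj₁ X-opt t)))

    W-opt : EvenOptimal W
    W-opt = W-even , W-min
      where
      W-even : ∀ t → lookup W t ≤ M × 2 ∣ lookup W t
      W-even t = subst (λ w → w ≤ M × 2 ∣ w) (sym (Vec.lookup-map t _ X)) (OnGrid-halve (proj₁ X-opt t))
      W-min : ∀ V → (∀ t → lookup V t ≤ M × 2 ∣ lookup V t) → C W ℚ.≤ C V
      W-min V V-even = begin
        C W                            ≡⟨ cost-scale β h fs W ⟨
        cost β fs (Vec.map (ℕ._* h) W) ≡⟨ cong (cost β fs) (unscale h∣X) ⟩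
        cost β fs X                    ≤⟨ proj₂ X-opt (Vec.map (ℕ._* h) V) V-on-grid ⟩
        cost β fs (Vec.map (ℕ._* h) V) ≡⟨ cost-scale β h fs V ⟩
        C V                            ∎
        where
        open ℚ.≤-Reasoning
        V-on-grid : ∀ t → OnGrid m (suc j) (lookup (Vec.map (ℕ._* h) V) t)
        V-on-grid t = subst (OnGrid m (suc j)) (sym (Vec.lookup-map t _ V)) (OnGrid-double (V-even t))

    dominated : ∀ Y → (∀ t → OnGrid m j (lookup Y t)) →
      ∃[ Y′ ] (∀ t → Nbhd m j (lookup X t) (lookup Y′ t)) × cost β fs Y′ ℚ.≤ cost β fs Y
    dominated Y Y-grid = Y′ , near , cheaper
      where
      U : Vec ℕ T
      U = Vec.map (_/ h) Y
      I : Vec (ℕ × ℕ) T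
      I = Vec.zip U W
      Y′ : Vec ℕ T
      Y′ = Vec.map (ℕ._* h) (Vec.map clampToBand I)
      lookup-I : ∀ t → lookup I t ≡ (lookup Y t / h , lookup X t / h)
      lookup-I t = trans (Vec.lookup-zip t U W) (cong₂ _,_ (Vec.lookup-map t _ Y) (Vec.lookup-map t _ X))
      adm : All Admissible I
      adm = lookup⁻ λ t →
        subst Admissible (sym (lookup-I t)) (OnGrid-/ (Y-grid t) , OnGrid-halve (proj₁ X-opt t))
      cheaper : cost β fs Y′ ℚ.≤ cost β fs Y
      cheaper = begin
        cost β fs Y′                   ≡⟨ cost-scale β h fs (Vec.map clampToBand I) ⟩
        C (Vec.map clampToBand I)      ≤⟨ clampToBand-cost adm I-opt ⟩
        C (Vec.map proj₁ I)            ≡⟨ cong C (Vec.map-proj₁-zip U W) ⟩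
        C U                            ≡⟨ cost-scale β h fs U ⟨
        cost β fs (Vec.map (ℕ._* h) U) ≡⟨ cong (cost β fs) (unscale h∣Y) ⟩
        cost β fs Y                    ∎
        where
        open ℚ.≤-Reasoning
        I-opt : EvenOptimal (Vec.map proj₂ I)
        I-opt = subst EvenOptimal (sym (Vec.map-proj₂-zip U W)) W-opt
        h∣Y : All (h ∣_) Y
        h∣Y = lookup⁻ (λ t → proj₂ (Y-grid t))
      near : ∀ t → Nbhd m j (lookup X t) (lookup Y′ t)
      near t = subst₂ (Nbhd m j) (m/n*n≡m (lookup⁺ h∣X t)) (sym lookup-Y′)
        (Nbhd-band {j = j} (ℕ.≤-trans (ℕ.*-monoˡ-≤ h c≤M) (m/n*n≤m m h))
                           (clampToBand-lower p) (clampToBand-upper p))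
        where
        p : ℕ × ℕ
        p = lookup Y t / h , lookup X t / h
        c≤M : clampToBand p ≤ M
        c≤M = clampToBand-≤ (OnGrid-/ (Y-grid t)) (proj₁ (OnGrid-halve (proj₁ X-opt t)))
        lookup-Y′ : lookup Y′ t ≡ clampToBand p ℕ.* h
        lookup-Y′ = trans (Vec.lookup-map t (ℕ._* h) (Vec.map clampToBand I))
                          (cong (ℕ._* h) (trans (Vec.lookup-map t clampToBand I) (cong clampToBand (lookup-I t))))

    refine : ∀ {X′} → MinCostAmong β fs (λ t → Nbhd m j (lookup X t)) X′ →
      MinCostAmong β fs (λ _ → OnGrid m j) X′
    refine = MinCostAmong-dominated β fs (λ t → Nbhd m j (lookup X t)) (λ _ → OnGrid m j)
      (λ {t} → Nbhd⇒OnGrid {j = j} (lookup⁺ h∣X t)) dominated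

downward-induction : ∀ (P : ℕ → Set) {K} → P K → (∀ j → suc j ≤ K → P (suc j) → P j) → P 0
downward-induction P {K} PK step = go K 0 (ℕ.+-identityʳ K)
  where
  go : ∀ d j → d + j ≡ K → P j
  go zero    j refl = PK
  go (suc d) j d+1+j≡K =
    step j (subst (suc j ≤_) d+1+j≡K (s≤s (ℕ.m≤n+m j d))) (go d (suc j) (trans (ℕ.+-suc d j) d+1+j≡K))

theorem2p6 : (T K : ℕ) (β : ℚ) → 0ℚ < β →
    (fs : Vec (ℕ → ℚ) T) → NonNeg (2 ^ (K + 2)) fs → Convex (2 ^ (K + 2)) fs →
    (X̂ : ℕ → Vec ℕ T) →
    MinCostAmong β fs (λ t x → CoarseGrid K x) (X̂ K) →
    (∀ j → suc j ≤ K →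
      MinCostAmong β fs (λ t x → Nbhd (2 ^ (K + 2)) j (lookup (X̂ (suc j)) t) x) (X̂ j)) →
    Optimal (2 ^ (K + 2)) β fs (X̂ 0)
theorem2p6 T K β 0<β fs _ convex X̂ coarse refined =
  MinCostAmong-cong β fs (λ _ → OnGrid m 0) (λ _ x → x ≤ m) OnGrid-0⇔≤
    (downward-induction (λ j → MinCostAmong β fs (λ _ → OnGrid m j) (X̂ j))
      (MinCostAmong-cong β fs (λ _ → CoarseGrid K) (λ _ → OnGrid m K) (CoarseGrid⇔OnGrid K) coarse)
      (λ j j<K on-grid → Refinement.refine β fs convex j on-grid (refined j j<K)))
  where
  m : ℕ
  m = 2 ^ (K + 2)
  instance
    0≤β : ℚ.NonNegative β
    0≤β = ℚ.nonNegative (ℚ.<⇒≤ 0<β)
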